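{- Let $M$ be a matching on the vertex set $[2n]$ that avoids the matching $\{\{1,4\},\{2,6\},\{3,5\}\}$, let $r\in[2n]$, and let $s<s'$ be two distinct stubs of the prefix $M[r]$. Then $s$ and $s'$ are equivalent in $M[r]$ if and only if $M[r]$ has an edge that covers both $s$ and $s'$.
   Context: A matching on $[2n]$ is a graph in which every vertex lies in exactly one edge. A matching $M$ contains a matching $M'$ on $[2m]$ if there is an increasing injection $f:[2m]\to[2n]$ such that $\{f(u),f(v)\}$ is an edge of $M$ whenever $\{u,v\}$ is an edge of $M'$; otherwise $M$ avoids $M'$. For $r\in[2n]$, $M[r]$ is the subgraph induced by the vertices $1,\dots,r$; its isolated vertices are called stubs. An edge $\{i,j\}$ with $i<j$ covers a vertex $x$ if $i<x<j$. An edge $\{i,j\}$ ($i<j$) crosses an edge $\{i',j'\}$ ($i'<j'$) from the left if $i<i'<j<j'$. A chain is a sequence of edges $(e_1,\dots,e_p)$, $p\ge1$, such that $e_t$ crosses $e_{t+1}$ from the left for each $t<p$. Two stubs $x<x'$ of $M[r]$ are equivalent in $M[r]$ if $M[r]$ contains a chain $(e_1,\dots,e_p)$ (possibly a single edge) with $x$ covered by $e_1$ and $x'$ covered by $e_p$. -}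

module Defs where

open import Data.Nat using (ℕ; _*_; _≤_)
open import Data.Fin using (Fin; toℕ; _<_; zero; suc)
open import Data.Product using (Σ; ∃; ∃-syntax; _×_; _,_)
open import Relation.Binary.PropositionalEquality using (_≡_; _≢_; refl)
open import Relation.Nullary using (¬_)

-- Vertices of [2n] are represented 0-based by Fin (2 * n): vertex x : Fin (2 * n)
-- stands for the paper's vertex toℕ x + 1.  Orders agree.
-- A (perfect) matching is given by its partner map: a fixed-point-free involution.
-- {i , j} is an edge iff partner i ≡ j.
record Matching (n : ℕ) : Set where
  field
    partner : Fin (2 * n) → Fin (2 * n)
    involutive : ∀ x → partner (partner x) ≡ x
    no-fixed : ∀ x → partner x ≢ x
open Matching public

StrictlyIncreasing : ∀ {a b} → (Fin a → Fin b) → Set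
StrictlyIncreasing f = ∀ u v → u < v → f u < f v

Contains : ∀ {n m} → Matching n → Matching m → Set
Contains {n} {m} M M' =
  Σ (Fin (2 * m) → Fin (2 * n)) λ f →
    StrictlyIncreasing f × (∀ u v → partner M' u ≡ v → partner M (f u) ≡ f v)

Avoids : ∀ {n m} → Matching n → Matching m → Set
Avoids M M' = ¬ Contains M M'

-- The pattern {{1,4},{2,6},{3,5}} on [6], 0-based: {0,3},{1,5},{2,4}.
pat : Fin 6 → Fin 6
pat zero = suc (suc (suc zero))
pat (suc zero) = suc (suc (suc (suc (suc zero))))
pat (suc (suc zero)) = suc (suc (suc (suc zero)))
pat (suc (suc (suc zero))) = zero
pat (suc (suc (suc (suc zero)))) = suc (suc zero)
pat (suc (suc (suc (suc (suc zero))))) = suc zero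

pat-invol : ∀ x → pat (pat x) ≡ x
pat-invol zero = refl
pat-invol (suc zero) = refl
pat-invol (suc (suc zero)) = refl
pat-invol (suc (suc (suc zero))) = refl
pat-invol (suc (suc (suc (suc zero)))) = refl
pat-invol (suc (suc (suc (suc (suc zero))))) = refl

pat-nofix : ∀ x → pat x ≢ x
pat-nofix zero ()
pat-nofix (suc zero) ()
pat-nofix (suc (suc zero)) ()
pat-nofix (suc (suc (suc zero))) ()
pat-nofix (suc (suc (suc (suc zero)))) ()
pat-nofix (suc (suc (suc (suc (suc zero))))) ()

M146235 : Matching 3
M146235 = record { partner = pat ; involutive = pat-invol ; no-fixed = pat-nofix }

-- Prefix M[r]: induced on the first r vertices, i.e. those x with toℕ x < r
-- (paper vertices 1..r).
InPrefix : ∀ {n} → ℕ → Fin (2 * n) → Set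
InPrefix r x = Data.Nat._<_ (toℕ x) r

record EdgeOf {n : ℕ} (M : Matching n) (r : ℕ) : Set where
  constructor edge
  field
    lo hi : Fin (2 * n)
    lo<hi : lo < hi
    mate : partner M lo ≡ hi
    hi-in : InPrefix {n} r hi
open EdgeOf public

-- Stub of M[r]: a vertex of M[r] that is isolated in M[r]
-- (its partner lies outside the prefix).
IsStub : ∀ {n} → Matching n → ℕ → Fin (2 * n) → Set
IsStub {n} M r x = InPrefix {n} r x × ¬ InPrefix {n} r (partner M x)

Covers : ∀ {n} {M : Matching n} {r} → EdgeOf M r → Fin (2 * n) → Set
Covers e x = lo e < x × x < hi e

CrossesLeft : ∀ {n} {M : Matching n} {r} → EdgeOf M r → EdgeOf M r → Set
CrossesLeft e e' = lo e < lo e' × lo e' < hi e × hi e < hi e'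

data Chain {n : ℕ} (M : Matching n) (r : ℕ) : EdgeOf M r → EdgeOf M r → Set where
  single : ∀ e → Chain M r e e
  step : ∀ e e' {g} → CrossesLeft e e' → Chain M r e' g → Chain M r e g

Equivalent : ∀ {n} → Matching n → ℕ → Fin (2 * n) → Fin (2 * n) → Set
Equivalent M r x x' =
  IsStub M r x × IsStub M r x' × x < x' ×
  (∃[ e₁ ] ∃[ eₚ ] (Chain M r e₁ eₚ × Covers e₁ x × Covers eₚ x'))

-- A chain propagates coverage of a stub s: if e covers s and crosses e' from the left, then
-- lo e' < s, for lo e' = s would give s a partner inside the prefix, and s < lo e' would give
-- lo e < s < lo e' < hi e < hi e' < partner s, the forbidden pattern 146235 (partner s lies
-- beyond the prefix, hence beyond hi e').  So the last edge of a chain whose first edge covers s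
-- still covers s, and if it covers s' it covers both.
module Submission where

open import Defs
open import Data.Nat as ℕ using (ℕ; _≤_; _*_; s≤s; z≤n)
open import Data.Nat.Properties using (<-≤-trans; ≮⇒≥)
open import Data.Fin using (Fin; _<_; zero; suc; inject₁)
open import Data.Fin.Properties using (<-trans; <-cmp)
open import Data.Product using (∃-syntax; _×_; _,_; proj₂)
open import Relation.Binary.PropositionalEquality using (_≡_; refl; sym; subst)
open import Relation.Binary.Definitions using (tri<; tri≈; tri>)
open import Relation.Nullary using (¬_)
open import Data.Empty using (⊥-elim)

strictlyIncreasing-by-steps : ∀ {k b} (f : Fin (ℕ.suc k) → Fin b) →
                              (∀ i → f (inject₁ i) < f (suc i)) → StrictlyIncreasing f
strictlyIncreasing-by-steps f inc zero zero ()
strictlyIncreasing-by-steps f inc (suc u) zero ()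
strictlyIncreasing-by-steps f inc zero (suc zero) _ = inc zero
strictlyIncreasing-by-steps {ℕ.suc k} f inc zero (suc (suc w)) _ =
  <-trans (inc zero)
          (strictlyIncreasing-by-steps (λ i → f (suc i)) (λ i → inc (suc i)) zero (suc w) (s≤s z≤n))
strictlyIncreasing-by-steps {ℕ.suc k} f inc (suc u) (suc v) (s≤s u<v) =
  strictlyIncreasing-by-steps (λ i → f (suc i)) (λ i → inc (suc i)) u v u<v

module _ {n : ℕ} (M : Matching n) where

  partner-sym : ∀ {x y} → partner M x ≡ y → partner M y ≡ x
  partner-sym {x} refl = involutive M x

  contains-146235 : (a b c d e f : Fin (2 * n)) →
                    a < b → b < c → c < d → d < e → e < f →
                    partner M a ≡ d → partner M b ≡ f → partner M c ≡ e → Contains M M146235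
  contains-146235 a b c d e f a<b b<c c<d d<e e<f ad bf ce =
    g , strictlyIncreasing-by-steps g steps , edges
    where
    g : Fin 6 → Fin (2 * n)
    g zero = a
    g (suc zero) = b
    g (suc (suc zero)) = c
    g (suc (suc (suc zero))) = d
    g (suc (suc (suc (suc zero)))) = e
    g (suc (suc (suc (suc (suc zero))))) = f

    steps : ∀ i → g (inject₁ i) < g (suc i)
    steps zero = a<b
    steps (suc zero) = b<c
    steps (suc (suc zero)) = c<d
    steps (suc (suc (suc zero))) = d<e
    steps (suc (suc (suc (suc zero)))) = e<f

    edges : ∀ u v → pat u ≡ v → partner M (g u) ≡ g v
    edges zero _ refl = ad
    edges (suc zero) _ refl = bf
    edges (suc (suc zero)) _ refl = ce
    edges (suc (suc (suc zero))) _ refl = partner-sym ad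
    edges (suc (suc (suc (suc zero)))) _ refl = partner-sym ce
    edges (suc (suc (suc (suc (suc zero))))) _ refl = partner-sym bf

  module _ (avoids : Avoids M M146235) {r : ℕ} {s : Fin (2 * n)}
           (partner-outside : ¬ InPrefix {n} r (partner M s)) where

    covers-crossesLeft : (e e' : EdgeOf M r) → CrossesLeft e e' → Covers e s → Covers e' s
    covers-crossesLeft e e' (_ , lo'<hi , hi<hi') (lo<s , s<hi) = lo'<s , <-trans s<hi hi<hi'
      where
      lo'<s : lo e' < s
      lo'<s with <-cmp (lo e') s
      ... | tri< lo'<s _ _ = lo'<s
      ... | tri≈ _ refl _ = ⊥-elim (partner-outside (subst (InPrefix {n} r) (sym (mate e')) (hi-in e')))
      ... | tri> _ _ s<lo' = ⊥-elim (avoids (contains-146235 (lo e) s (lo e') (hi e) (hi e') (partner M s)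
              lo<s s<lo' lo'<hi hi<hi' (<-≤-trans (hi-in e') (≮⇒≥ partner-outside))
              (mate e) refl (mate e')))

    covers-chain : ∀ {e g} → Chain M r e g → Covers e s → Covers g s
    covers-chain (single _) cov = cov
    covers-chain (step e e' cross chain) cov = covers-chain chain (covers-crossesLeft e e' cross cov)

lemma14 : (n : ℕ) (M : Matching n) → Avoids M M146235 →
          (r : ℕ) → 1 ≤ r → r ≤ 2 * n →
          (s s' : Fin (2 * n)) → IsStub M r s → IsStub M r s' → s < s' →
          (Equivalent M r s s' → ∃[ e ] (Covers {M = M} {r = r} e s × Covers e s'))
          × (∃[ e ] (Covers {M = M} {r = r} e s × Covers e s') → Equivalent M r s s')
lemma14 n M avoids r _ _ s s' stub stub' s<s' = chain-to-edge , edge-to-chain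
  where
  chain-to-edge : Equivalent M r s s' → ∃[ e ] (Covers {M = M} {r = r} e s × Covers e s')
  chain-to-edge (_ , _ , _ , _ , eₚ , chain , cov₁ , covₚ) =
    eₚ , covers-chain M avoids (proj₂ stub) chain cov₁ , covₚ

  edge-to-chain : ∃[ e ] (Covers {M = M} {r = r} e s × Covers e s') → Equivalent M r s s'
  edge-to-chain (e , cov , cov') = stub , stub' , s<s' , e , e , single e , cov , cov'
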